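{- Let $n\ge 2$ be an integer. Then $d_4(n,n-1)=1$ if $n$ is even, and $d_4(n,n-1)=2$ if $n$ is odd.
   Context: Let $\mathbb{F}_4=\{0,1,\omega,\omega^2\}$ with $\omega^2=\omega+1$, and for $x\in\mathbb{F}_4$ let $\overline{x}=x^2$. An $[n,k]_4$ code is a $k$-dimensional subspace $C$ of $\mathbb{F}_4^n$. Its minimum weight is the smallest number of nonzero coordinates of a nonzero vector of $C$. The Hermitian dual is $C^{\perp_H}=\{x\in\mathbb{F}_4^n:\sum_i x_i\overline{y_i}=0\ \forall y\in C\}$, and $C$ is Hermitian LCD if $C\cap C^{\perp_H}=\{\mathbf{0}_n\}$. $d_4(n,k)$ denotes the largest minimum weight among all Hermitian LCD $[n,k]_4$ codes. -}

module Defs where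

open import Data.Nat using (ℕ; zero; suc; _≤_)
open import Data.Vec using (Vec; []; _∷_; replicate; zipWith; map; foldr)
open import Data.Product using (Σ; ∃; _×_; _,_)
open import Relation.Binary.PropositionalEquality using (_≡_; _≢_)

-- The field F4 = {0, 1, ω, ω²} with ω² = ω + 1 (characteristic 2).
data F4 : Set where
  𝟘 𝟙 ω ω² : F4

infixl 6 _+F_
infixl 7 _*F_

_+F_ : F4 → F4 → F4
𝟘  +F y  = y
x  +F 𝟘  = x
𝟙  +F 𝟙  = 𝟘
𝟙  +F ω  = ω²
𝟙  +F ω² = ω
ω  +F 𝟙  = ω²
ω  +F ω  = 𝟘
ω  +F ω² = 𝟙
ω² +F 𝟙  = ω
ω² +F ω  = 𝟙
ω² +F ω² = 𝟘

_*F_ : F4 → F4 → F4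
𝟘  *F y  = 𝟘
x  *F 𝟘  = 𝟘
𝟙  *F y  = y
x  *F 𝟙  = x
ω  *F ω  = ω²
ω  *F ω² = 𝟙
ω² *F ω  = 𝟙
ω² *F ω² = ω

conj : F4 → F4
conj x = x *F x

Word : ℕ → Set
Word n = Vec F4 n

zeroWord : ∀ {n} → Word n
zeroWord = replicate _ 𝟘

_⊕_ : ∀ {n} → Word n → Word n → Word n
_⊕_ = zipWith _+F_

scale : ∀ {n} → F4 → Word n → Word n
scale c = map (c *F_)

lin : ∀ {n k} → Vec F4 k → Vec (Word n) k → Word n
lin []       []       = zeroWord
lin (c ∷ cs) (g ∷ gs) = scale c g ⊕ lin cs gs

InCode : ∀ {n k} → Vec (Word n) k → Word n → Set
InCode G x = ∃ λ c → lin c G ≡ x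

LinIndep : ∀ {n k} → Vec (Word n) k → Set
LinIndep G = ∀ c → lin c G ≡ zeroWord → c ≡ zeroWord

hdot : ∀ {n} → Word n → Word n → F4
hdot x y = foldr _ _+F_ 𝟘 (zipWith (λ a b → a *F conj b) x y)

HermitianLCD : ∀ {n k} → Vec (Word n) k → Set
HermitianLCD G = ∀ x → InCode G x → (∀ y → InCode G y → hdot x y ≡ 𝟘) → x ≡ zeroWord

weight : ∀ {n} → Word n → ℕ
weight []        = zero
weight (𝟘 ∷ xs)  = weight xs
weight (𝟙 ∷ xs)  = suc (weight xs)
weight (ω ∷ xs)  = suc (weight xs)
weight (ω² ∷ xs) = suc (weight xs)

MinWeight : ∀ {n k} → Vec (Word n) k → ℕ → Set
MinWeight G d =
  (∃ λ x → InCode G x × x ≢ zeroWord × weight x ≡ d) ×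
  (∀ x → InCode G x → x ≢ zeroWord → d ≤ weight x)

-- An [n,k]_4 code, given by a generator matrix with k independent rows.
-- d₄(n,k) = d : d is the largest minimum weight among Hermitian LCD [n,k]_4 codes.
D4≡ : ℕ → ℕ → ℕ → Set
D4≡ n k d =
  (Σ (Vec (Word n) k) λ G → LinIndep G × HermitianLCD G × MinWeight G d) ×
  (∀ (G : Vec (Word n) k) d' → LinIndep G → HermitianLCD G → MinWeight G d' → d' ≤ d)

module Submission where

-- A code C of dimension n − 1 in F4^n is the hyperplane v^⊥ of a normal vector v, and it is
-- Hermitian LCD exactly when v is non-isotropic, hdot v v ≠ 0. Every such hyperplane contains a
-- nonzero word of weight ≤ 2. When n is even, a non-isotropic v has a zero coordinate, since
-- x x̄ = x³ = 1 for x ≠ 0 would give hdot v v = n · 1 = 0; so v^⊥ contains a unit vector.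
-- The bounds are attained by the codes with generator matrices [0 | I] and [1 | I]: their normals
-- (1,0,…,0) and (1,…,1) are non-isotropic (the latter for n odd), and a nonzero word orthogonal
-- to the full-support vector (1,…,1) has weight at least 2.

open import Defs
open import Data.Nat using (ℕ; zero; suc; _^_; _≤_; _<_; _∸_; _%_; z≤n; s≤s)
open import Data.Nat.Properties using (≤-refl; ≤-trans; ≤-reflexive; ≤-antisym; n≤1+n; ^-monoʳ-<)
open import Data.Fin as Fin using (Fin; combine; remQuot)
open import Data.Fin.Patterns using (0F; 1F; 2F; 3F)
open import Data.Fin.Properties using (pigeonhole; remQuot-combine; combine-remQuot; <⇒≢)
open import Data.Empty using (⊥-elim)
open import Data.Product using (∃; _×_; _,_; uncurry)
open import Data.Sum using (_⊎_; inj₁; inj₂)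
open import Data.Vec using (Vec; []; _∷_; head; tail; replicate; zipWith; map; transpose)
open import Data.Vec.Properties
  using (zipWith-comm; zipWith-assoc; zipWith-identityˡ; zipWith-is-⊛; map-const; map-cong; map-replicate)
open import Data.Vec.Relation.Unary.All using (All; []; _∷_)
open import Function using (_∘_)
open import Relation.Binary.Definitions using (DecidableEquality)
open import Relation.Binary.PropositionalEquality
  using (_≡_; _≢_; refl; sym; trans; cong; cong₂; subst; module ≡-Reasoning)
open import Relation.Nullary using (¬_; Dec; yes; no)
open import Relation.Nullary.Decidable using (map′; _×-dec_; _→-dec_; ¬?; from-yes; decidable-stable)
open import Relation.Unary using (Decidable)

open ≡-Reasoning

toFin : F4 → Fin 4
toFin 𝟘  = 0F
toFin 𝟙  = 1F
toFin ω  = 2F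
toFin ω² = 3F

fromFin : Fin 4 → F4
fromFin 0F = 𝟘
fromFin 1F = 𝟙
fromFin 2F = ω
fromFin 3F = ω²

fromFin-toFin : ∀ x → fromFin (toFin x) ≡ x
fromFin-toFin 𝟘  = refl
fromFin-toFin 𝟙  = refl
fromFin-toFin ω  = refl
fromFin-toFin ω² = refl

toFin-fromFin : ∀ i → toFin (fromFin i) ≡ i
toFin-fromFin 0F = refl
toFin-fromFin 1F = refl
toFin-fromFin 2F = refl
toFin-fromFin 3F = refl

toFin-injective : ∀ {x y} → toFin x ≡ toFin y → x ≡ y
toFin-injective {x} {y} e = trans (sym (fromFin-toFin x)) (trans (cong fromFin e) (fromFin-toFin y))

infix 4 _≟F_
_≟F_ : DecidableEquality F4
x ≟F y = map′ toFin-injective (cong toFin) (toFin x Fin.≟ toFin y)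

∀F4? : {P : F4 → Set} → Decidable P → Dec (∀ x → P x)
∀F4? P? = map′ (λ { (p , _) 𝟘 → p ; (_ , p , _) 𝟙 → p ; (_ , _ , p , _) ω → p ; (_ , _ , _ , p) ω² → p })
               (λ p → p 𝟘 , p 𝟙 , p ω , p ω²)
               (P? 𝟘 ×-dec P? 𝟙 ×-dec P? ω ×-dec P? ω²)

+F-comm : ∀ x y → x +F y ≡ y +F x
+F-comm = from-yes (∀F4? λ x → ∀F4? λ y → x +F y ≟F y +F x)

+F-assoc : ∀ x y z → x +F y +F z ≡ x +F (y +F z)
+F-assoc = from-yes (∀F4? λ x → ∀F4? λ y → ∀F4? λ z → x +F y +F z ≟F x +F (y +F z))

+F-identityʳ : ∀ x → x +F 𝟘 ≡ x
+F-identityʳ = from-yes (∀F4? λ x → x +F 𝟘 ≟F x)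

+F-self : ∀ x → x +F x ≡ 𝟘
+F-self = from-yes (∀F4? λ x → x +F x ≟F 𝟘)

+F-interchange : ∀ w x y z → (w +F x) +F (y +F z) ≡ (w +F y) +F (x +F z)
+F-interchange = from-yes (∀F4? λ w → ∀F4? λ x → ∀F4? λ y → ∀F4? λ z → (w +F x) +F (y +F z) ≟F (w +F y) +F (x +F z))

*F-comm : ∀ x y → x *F y ≡ y *F x
*F-comm = from-yes (∀F4? λ x → ∀F4? λ y → x *F y ≟F y *F x)

*F-assoc : ∀ x y z → x *F y *F z ≡ x *F (y *F z)
*F-assoc = from-yes (∀F4? λ x → ∀F4? λ y → ∀F4? λ z → x *F y *F z ≟F x *F (y *F z))

*F-identityʳ : ∀ x → x *F 𝟙 ≡ x
*F-identityʳ = from-yes (∀F4? λ x → x *F 𝟙 ≟F x)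

*F-identityˡ : ∀ x → 𝟙 *F x ≡ x
*F-identityˡ = from-yes (∀F4? λ x → 𝟙 *F x ≟F x)

*F-zeroʳ : ∀ x → x *F 𝟘 ≡ 𝟘
*F-zeroʳ = from-yes (∀F4? λ x → x *F 𝟘 ≟F 𝟘)

*F-distribˡ-+F : ∀ x y z → x *F (y +F z) ≡ x *F y +F x *F z
*F-distribˡ-+F = from-yes (∀F4? λ x → ∀F4? λ y → ∀F4? λ z → x *F (y +F z) ≟F x *F y +F x *F z)

*F-distribʳ-+F : ∀ x y z → (x +F y) *F z ≡ x *F z +F y *F z
*F-distribʳ-+F = from-yes (∀F4? λ x → ∀F4? λ y → ∀F4? λ z → (x +F y) *F z ≟F x *F z +F y *F z)

*F-noZeroDivisors : ∀ x y → x *F y ≡ 𝟘 → y ≢ 𝟘 → x ≡ 𝟘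
*F-noZeroDivisors = from-yes (∀F4? λ x → ∀F4? λ y → (x *F y ≟F 𝟘) →-dec ¬? (y ≟F 𝟘) →-dec (x ≟F 𝟘))

-- conj x = x² is the inverse of x ≠ 0, since x³ = 1 in F4.
conj-inverseˡ : ∀ x → x ≢ 𝟘 → conj x *F x ≡ 𝟙
conj-inverseˡ = from-yes (∀F4? λ x → ¬? (x ≟F 𝟘) →-dec (conj x *F x ≟F 𝟙))

conj-involutive : ∀ x → conj (conj x) ≡ x
conj-involutive = from-yes (∀F4? λ x → conj (conj x) ≟F x)

conj-+F : ∀ x y → conj (x +F y) ≡ conj x +F conj y
conj-+F = from-yes (∀F4? λ x → ∀F4? λ y → conj (x +F y) ≟F conj x +F conj y)

conj-*F-conj : ∀ x y → conj (x *F conj y) ≡ y *F conj x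
conj-*F-conj = from-yes (∀F4? λ x → ∀F4? λ y → conj (x *F conj y) ≟F y *F conj x)

conj-zero : ∀ x → conj x ≡ 𝟘 → x ≡ 𝟘
conj-zero = from-yes (∀F4? λ x → (conj x ≟F 𝟘) →-dec (x ≟F 𝟘))

*F-conj-nonzero : ∀ x y → x ≢ 𝟘 → y ≢ 𝟘 → x *F conj y ≢ 𝟘
*F-conj-nonzero = from-yes (∀F4? λ x → ∀F4? λ y → ¬? (x ≟F 𝟘) →-dec ¬? (y ≟F 𝟘) →-dec ¬? (x *F conj y ≟F 𝟘))

fromℕ : ℕ → F4
fromℕ zero    = 𝟘
fromℕ (suc n) = 𝟙 +F fromℕ n

fromℕ-mod2 : ∀ n → fromℕ n ≡ fromℕ (n % 2)
fromℕ-mod2 zero          = refl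
fromℕ-mod2 (suc zero)    = refl
fromℕ-mod2 (suc (suc n)) = trans (sym (+F-assoc 𝟙 𝟙 (fromℕ n))) (fromℕ-mod2 n)

infixl 7 _·_
_·_ : ∀ {n} → Word n → Word n → F4
[]       · []       = 𝟘
(x ∷ xs) · (y ∷ ys) = x *F y +F xs · ys

·-comm : ∀ {n} (x y : Word n) → x · y ≡ y · x
·-comm []       []       = refl
·-comm (x ∷ xs) (y ∷ ys) = cong₂ _+F_ (*F-comm x y) (·-comm xs ys)

·-zeroʳ : ∀ {n} (x : Word n) → x · zeroWord ≡ 𝟘
·-zeroʳ []       = refl
·-zeroʳ (x ∷ xs) = cong₂ _+F_ (*F-zeroʳ x) (·-zeroʳ xs)

⊕-comm : ∀ {n} (x y : Word n) → x ⊕ y ≡ y ⊕ x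
⊕-comm = zipWith-comm +F-comm

⊕-assoc : ∀ {n} (x y z : Word n) → (x ⊕ y) ⊕ z ≡ x ⊕ (y ⊕ z)
⊕-assoc = zipWith-assoc +F-assoc

⊕-identityˡ : ∀ {n} (x : Word n) → zeroWord ⊕ x ≡ x
⊕-identityˡ = zipWith-identityˡ λ _ → refl

⊕-identityʳ : ∀ {n} (x : Word n) → x ⊕ zeroWord ≡ x
⊕-identityʳ x = trans (⊕-comm x zeroWord) (⊕-identityˡ x)

⊕-self : ∀ {n} (x : Word n) → x ⊕ x ≡ zeroWord
⊕-self []       = refl
⊕-self (x ∷ xs) = cong₂ _∷_ (+F-self x) (⊕-self xs)

⊕-cancel : ∀ {n} {x y : Word n} → x ⊕ y ≡ zeroWord → x ≡ y
⊕-cancel {x = x} {y} x⊕y≡0 = begin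
  x                 ≡⟨ sym (⊕-identityʳ x) ⟩
  x ⊕ zeroWord      ≡⟨ cong (x ⊕_) (sym (⊕-self y)) ⟩
  x ⊕ (y ⊕ y)       ≡⟨ sym (⊕-assoc x y y) ⟩
  (x ⊕ y) ⊕ y       ≡⟨ cong (_⊕ y) x⊕y≡0 ⟩
  zeroWord ⊕ y      ≡⟨ ⊕-identityˡ y ⟩
  y                 ∎

⊕-interchange : ∀ {n} (w x y z : Word n) → (w ⊕ x) ⊕ (y ⊕ z) ≡ (w ⊕ y) ⊕ (x ⊕ z)
⊕-interchange w x y z = begin
  (w ⊕ x) ⊕ (y ⊕ z)   ≡⟨ ⊕-assoc w x (y ⊕ z) ⟩
  w ⊕ (x ⊕ (y ⊕ z))   ≡⟨ cong (w ⊕_) (sym (⊕-assoc x y z)) ⟩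
  w ⊕ ((x ⊕ y) ⊕ z)   ≡⟨ cong (λ t → w ⊕ (t ⊕ z)) (⊕-comm x y) ⟩
  w ⊕ ((y ⊕ x) ⊕ z)   ≡⟨ cong (w ⊕_) (⊕-assoc y x z) ⟩
  w ⊕ (y ⊕ (x ⊕ z))   ≡⟨ sym (⊕-assoc w y (x ⊕ z)) ⟩
  (w ⊕ y) ⊕ (x ⊕ z)   ∎

scale-𝟘 : ∀ {n} (x : Word n) → scale 𝟘 x ≡ zeroWord
scale-𝟘 x = map-const x 𝟘

scale-zeroWord : ∀ {n} a → scale a (zeroWord {n}) ≡ zeroWord
scale-zeroWord {n} a = trans (map-replicate (a *F_) 𝟘 n) (cong (replicate n) (*F-zeroʳ a))

scale-distribˡ : ∀ {n} a (x y : Word n) → scale a (x ⊕ y) ≡ scale a x ⊕ scale a y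
scale-distribˡ a []       []       = refl
scale-distribˡ a (x ∷ xs) (y ∷ ys) = cong₂ _∷_ (*F-distribˡ-+F a x y) (scale-distribˡ a xs ys)

scale-distribʳ : ∀ {n} a b (x : Word n) → scale (a +F b) x ≡ scale a x ⊕ scale b x
scale-distribʳ a b []       = refl
scale-distribʳ a b (x ∷ xs) = cong₂ _∷_ (*F-distribʳ-+F a b x) (scale-distribʳ a b xs)

scale-scale : ∀ {n} a b (x : Word n) → scale a (scale b x) ≡ scale (a *F b) x
scale-scale a b []       = refl
scale-scale a b (x ∷ xs) = cong₂ _∷_ (sym (*F-assoc a b x)) (scale-scale a b xs)

scale-𝟙 : ∀ {n} (x : Word n) → scale 𝟙 x ≡ x
scale-𝟙 []       = refl
scale-𝟙 (x ∷ xs) = cong₂ _∷_ (*F-identityˡ x) (scale-𝟙 xs)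

lin-⊕ : ∀ {n k} (c d : Word k) (vs : Vec (Word n) k) → lin (c ⊕ d) vs ≡ lin c vs ⊕ lin d vs
lin-⊕ []      []      []       = sym (⊕-identityˡ zeroWord)
lin-⊕ (a ∷ c) (b ∷ d) (v ∷ vs) = begin
  scale (a +F b) v ⊕ lin (c ⊕ d) vs                ≡⟨ cong₂ _⊕_ (scale-distribʳ a b v) (lin-⊕ c d vs) ⟩
  (scale a v ⊕ scale b v) ⊕ (lin c vs ⊕ lin d vs)  ≡⟨ ⊕-interchange _ _ _ _ ⟩
  (scale a v ⊕ lin c vs) ⊕ (scale b v ⊕ lin d vs)  ∎

lin-scale : ∀ {n k} a (c : Word k) (vs : Vec (Word n) k) → lin (scale a c) vs ≡ scale a (lin c vs)
lin-scale a []      []       = sym (scale-zeroWord a)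
lin-scale a (b ∷ c) (v ∷ vs) = begin
  scale (a *F b) v ⊕ lin (scale a c) vs    ≡⟨ cong₂ _⊕_ (sym (scale-scale a b v)) (lin-scale a c vs) ⟩
  scale a (scale b v) ⊕ scale a (lin c vs) ≡⟨ sym (scale-distribˡ a _ _) ⟩
  scale a (scale b v ⊕ lin c vs)           ∎

lin-zipWith-∷ : ∀ {n k} (c g : Word k) (T : Vec (Word n) k) →
  lin c (zipWith _∷_ g T) ≡ g · c ∷ lin c T
lin-zipWith-∷ []      []      []      = refl
lin-zipWith-∷ (a ∷ c) (x ∷ g) (t ∷ T) = begin
  scale a (x ∷ t) ⊕ lin c (zipWith _∷_ g T)  ≡⟨ cong (scale a (x ∷ t) ⊕_) (lin-zipWith-∷ c g T) ⟩
  a *F x +F g · c ∷ scale a t ⊕ lin c T      ≡⟨ cong (λ s → s +F g · c ∷ scale a t ⊕ lin c T) (*F-comm a x) ⟩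
  x *F a +F g · c ∷ scale a t ⊕ lin c T      ∎

lin-transpose : ∀ {n k} (c : Word n) (G : Vec (Word n) k) → lin c (transpose G) ≡ map (_· c) G
lin-transpose {n} c []  with lin c (transpose {n = n} [])
... | [] = refl
lin-transpose c (g ∷ G) = begin
  lin c (transpose (g ∷ G))         ≡⟨ cong (lin c) (sym (zipWith-is-⊛ _∷_ g (transpose G))) ⟩
  lin c (zipWith _∷_ g (transpose G)) ≡⟨ lin-zipWith-∷ c g (transpose G) ⟩
  g · c ∷ lin c (transpose G)       ≡⟨ cong (g · c ∷_) (lin-transpose c G) ⟩
  g · c ∷ map (_· c) G              ∎

encode : ∀ {n} → Word n → Fin (4 ^ n)
encode []       = Fin.zero
encode (x ∷ xs) = combine (toFin x) (encode xs)

decode : ∀ {n} → Fin (4 ^ n) → Word n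
decode {zero}  _ = []
decode {suc n} i = uncurry (λ a j → fromFin a ∷ decode {n} j) (remQuot {4} (4 ^ n) i)

decode-encode : ∀ {n} (x : Word n) → decode (encode x) ≡ x
decode-encode []       = refl
decode-encode {suc n} (x ∷ xs) =
  trans (cong (uncurry (λ a j → fromFin a ∷ decode {n} j)) (remQuot-combine (toFin x) (encode xs)))
        (cong₂ _∷_ (fromFin-toFin x) (decode-encode xs))

encode-decode : ∀ {n} (i : Fin (4 ^ n)) → encode (decode {n} i) ≡ i
encode-decode {zero}  Fin.zero = refl
encode-decode {suc n} i = trans (encode-cons (remQuot {4} (4 ^ n) i)) (combine-remQuot {4} (4 ^ n) i)
  where
  encode-cons : ∀ (p : Fin 4 × Fin (4 ^ n)) →
    encode {suc n} (uncurry (λ a j → fromFin a ∷ decode {n} j) p) ≡ uncurry combine p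
  encode-cons (a , j) = cong₂ combine (toFin-fromFin a) (encode-decode {n} j)

encode-injective : ∀ {n} {x y : Word n} → encode x ≡ encode y → x ≡ y
encode-injective {x = x} {y} e = trans (sym (decode-encode x)) (trans (cong decode e) (decode-encode y))

decode-injective : ∀ {n} {i j : Fin (4 ^ n)} → decode {n} i ≡ decode {n} j → i ≡ j
decode-injective {n} {i} {j} e = trans (sym (encode-decode {n} i)) (trans (cong encode e) (encode-decode {n} j))

Dependent : ∀ {n k} → Vec (Word n) k → Set
Dependent vs = ∃ λ c → c ≢ zeroWord × lin c vs ≡ zeroWord

≢-combinations⇒Dependent : ∀ {n k} {vs : Vec (Word n) k} {c d : Word k} →
  c ≢ d → lin c vs ≡ lin d vs → Dependent vs
≢-combinations⇒Dependent {vs = vs} {c} {d} c≢d same = c ⊕ d , c≢d ∘ ⊕-cancel , (begin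
  lin (c ⊕ d) vs        ≡⟨ lin-⊕ c d vs ⟩
  lin c vs ⊕ lin d vs   ≡⟨ cong (_⊕ lin d vs) same ⟩
  lin d vs ⊕ lin d vs   ≡⟨ ⊕-self (lin d vs) ⟩
  zeroWord              ∎)

-- There are 4^k coefficient vectors but only 4^m words.
dependent : ∀ {m k} → m < k → (vs : Vec (Word m) k) → Dependent vs
dependent {m} {k} m<k vs
  with i , j , i<j , same ←
    pigeonhole (^-monoʳ-< 4 (s≤s (s≤s z≤n)) m<k) (encode ∘ (λ c → lin c vs) ∘ decode {k})
  = ≢-combinations⇒Dependent {c = decode {k} i} {decode {k} j}
      (<⇒≢ i<j ∘ decode-injective {k}) (encode-injective same)

infix 4 _⟂_
_⟂_ : ∀ {n} → Word n → Word n → Set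
x ⟂ y = hdot x y ≡ 𝟘

hdot-zeroˡ : ∀ {n} (y : Word n) → hdot zeroWord y ≡ 𝟘
hdot-zeroˡ []       = refl
hdot-zeroˡ (y ∷ ys) = hdot-zeroˡ ys

hdot-⊕ˡ : ∀ {n} (x y z : Word n) → hdot (x ⊕ y) z ≡ hdot x z +F hdot y z
hdot-⊕ˡ []       []       []       = refl
hdot-⊕ˡ (x ∷ xs) (y ∷ ys) (z ∷ zs) = begin
  (x +F y) *F conj z +F hdot (xs ⊕ ys) zs
    ≡⟨ cong₂ _+F_ (*F-distribʳ-+F x y (conj z)) (hdot-⊕ˡ xs ys zs) ⟩
  (x *F conj z +F y *F conj z) +F (hdot xs zs +F hdot ys zs)
    ≡⟨ +F-interchange (x *F conj z) (y *F conj z) (hdot xs zs) (hdot ys zs) ⟩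
  (x *F conj z +F hdot xs zs) +F (y *F conj z +F hdot ys zs)
    ∎

hdot-scaleˡ : ∀ {n} a (x y : Word n) → hdot (scale a x) y ≡ a *F hdot x y
hdot-scaleˡ a []       []       = sym (*F-zeroʳ a)
hdot-scaleˡ a (x ∷ xs) (y ∷ ys) = begin
  a *F x *F conj y +F hdot (scale a xs) ys      ≡⟨ cong₂ _+F_ (*F-assoc a x (conj y)) (hdot-scaleˡ a xs ys) ⟩
  a *F (x *F conj y) +F a *F hdot xs ys         ≡⟨ sym (*F-distribˡ-+F a _ _) ⟩
  a *F (x *F conj y +F hdot xs ys)              ∎

hdot-conj-sym : ∀ {n} (x y : Word n) → hdot x y ≡ conj (hdot y x)
hdot-conj-sym []       []       = refl
hdot-conj-sym (x ∷ xs) (y ∷ ys) = begin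
  x *F conj y +F hdot xs ys                    ≡⟨ cong₂ _+F_ (sym (conj-*F-conj y x)) (hdot-conj-sym xs ys) ⟩
  conj (y *F conj x) +F conj (hdot ys xs)      ≡⟨ sym (conj-+F (y *F conj x) (hdot ys xs)) ⟩
  conj (y *F conj x +F hdot ys xs)             ∎

⟂-sym : ∀ {n} (x y : Word n) → x ⟂ y → y ⟂ x
⟂-sym x y x⟂y = trans (hdot-conj-sym y x) (cong conj x⟂y)

hdot-map-conj : ∀ {n} (x y : Word n) → hdot x (map conj y) ≡ x · y
hdot-map-conj []       []       = refl
hdot-map-conj (x ∷ xs) (y ∷ ys) = cong₂ _+F_ (cong (x *F_) (conj-involutive y)) (hdot-map-conj xs ys)

hdot-lin : ∀ {n k} (c : Word k) (vs : Vec (Word n) k) (y : Word n) →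
  hdot (lin c vs) y ≡ c · map (λ u → hdot u y) vs
hdot-lin []      []       y = hdot-zeroˡ y
hdot-lin (a ∷ c) (v ∷ vs) y = begin
  hdot (scale a v ⊕ lin c vs) y              ≡⟨ hdot-⊕ˡ (scale a v) (lin c vs) y ⟩
  hdot (scale a v) y +F hdot (lin c vs) y    ≡⟨ cong₂ _+F_ (hdot-scaleˡ a v y) (hdot-lin c vs y) ⟩
  a *F hdot v y +F c · map (λ u → hdot u y) vs ∎

nondegenerate : ∀ {n} {y : Word n} → (∀ u → u ⟂ y) → y ≡ zeroWord
nondegenerate {y = []}     _    = refl
nondegenerate {y = a ∷ y} ⟂y = cong₂ _∷_ a≡𝟘 (nondegenerate λ u → ⟂y (𝟘 ∷ u))
  where
  a≡𝟘 : a ≡ 𝟘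
  a≡𝟘 = conj-zero a (begin
    conj a                                ≡⟨ sym (*F-identityˡ (conj a)) ⟩
    𝟙 *F conj a                           ≡⟨ sym (+F-identityʳ _) ⟩
    𝟙 *F conj a +F 𝟘                      ≡⟨ cong (𝟙 *F conj a +F_) (sym (hdot-zeroˡ y)) ⟩
    𝟙 *F conj a +F hdot zeroWord y        ≡⟨ ⟂y (𝟙 ∷ zeroWord) ⟩
    𝟘                                     ∎)

map-conj-zero : ∀ {n} (c : Word n) → map conj c ≡ zeroWord → c ≡ zeroWord
map-conj-zero []      _ = refl
map-conj-zero (a ∷ c) e = cong₂ _∷_ (conj-zero a (cong head e)) (map-conj-zero c (cong tail e))

Normal : ∀ {n k} → Vec (Word n) k → Word n → Set
Normal G v = ∀ x → InCode G x → x ⟂ v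

normal-exists : ∀ {k} (G : Vec (Word (suc k)) k) → ∃ λ v → v ≢ zeroWord × Normal G v
normal-exists G with dependent ≤-refl (transpose G)
... | c , c≢0 , relation = map conj c , c≢0 ∘ map-conj-zero c , normal
  where
  rows⟂ : map (λ g → hdot g (map conj c)) G ≡ zeroWord
  rows⟂ = trans (map-cong (λ g → hdot-map-conj g c) G) (trans (sym (lin-transpose c G)) relation)
  normal : Normal G (map conj c)
  normal _ (d , refl) = trans (hdot-lin d G (map conj c)) (trans (cong (d ·_) rows⟂) (·-zeroʳ d))

relation⇒InCode : ∀ {n k} {G : Vec (Word n) k} {p : Word n} {a : F4} {c : Word k} →
  LinIndep G → a ∷ c ≢ zeroWord → scale a p ⊕ lin c G ≡ zeroWord → InCode G p
relation⇒InCode {G = G} {p} {a} {c} indep nontrivial relation with a ≟F 𝟘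
... | yes refl = ⊥-elim (nontrivial (cong (𝟘 ∷_) (indep c (begin
  lin c G                   ≡⟨ sym (⊕-identityˡ (lin c G)) ⟩
  zeroWord ⊕ lin c G        ≡⟨ cong (_⊕ lin c G) (sym (scale-𝟘 p)) ⟩
  scale 𝟘 p ⊕ lin c G       ≡⟨ relation ⟩
  zeroWord                  ∎))))
... | no a≢𝟘 = scale (conj a) c , (begin
  lin (scale (conj a) c) G     ≡⟨ lin-scale (conj a) c G ⟩
  scale (conj a) (lin c G)     ≡⟨ cong (scale (conj a)) (sym (⊕-cancel relation)) ⟩
  scale (conj a) (scale a p)   ≡⟨ scale-scale (conj a) a p ⟩
  scale (conj a *F a) p        ≡⟨ cong (λ z → scale z p) (conj-inverseˡ a a≢𝟘) ⟩
  scale 𝟙 p                    ≡⟨ scale-𝟙 p ⟩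
  p                            ∎)

-- The k rows, q and p are k+2 dependent words in F4^(k+1); pairing the relation with v
-- kills the coefficient of q, so p is a combination of the rows.
⟂⇒InCode : ∀ {k} {G : Vec (Word (suc k)) k} {v p : Word (suc k)} →
  LinIndep G → Normal G v → (q : Word (suc k)) → ¬ q ⟂ v → p ⟂ v → InCode G p
⟂⇒InCode {G = G} {v} {p} indep normal q q̸⟂v p⟂v with dependent ≤-refl (q ∷ p ∷ G)
... | b ∷ a ∷ c , nontrivial , relation =
  relation⇒InCode indep (nontrivial ∘ cong₂ _∷_ b≡𝟘) rest≡0
  where
  rest = scale a p ⊕ lin c G
  rest⟂v : rest ⟂ v
  rest⟂v = begin
    hdot rest v                                 ≡⟨ hdot-⊕ˡ (scale a p) (lin c G) v ⟩
    hdot (scale a p) v +F hdot (lin c G) v      ≡⟨ cong₂ _+F_ (hdot-scaleˡ a p v) (normal _ (c , refl)) ⟩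
    a *F hdot p v +F 𝟘                          ≡⟨ +F-identityʳ _ ⟩
    a *F hdot p v                               ≡⟨ cong (a *F_) p⟂v ⟩
    a *F 𝟘                                      ≡⟨ *F-zeroʳ a ⟩
    𝟘                                           ∎
  b≡𝟘 : b ≡ 𝟘
  b≡𝟘 = *F-noZeroDivisors b (hdot q v) (begin
    b *F hdot q v                           ≡⟨ sym (+F-identityʳ _) ⟩
    b *F hdot q v +F 𝟘                      ≡⟨ cong (b *F hdot q v +F_) (sym rest⟂v) ⟩
    b *F hdot q v +F hdot rest v            ≡⟨ cong (_+F hdot rest v) (sym (hdot-scaleˡ b q v)) ⟩
    hdot (scale b q) v +F hdot rest v       ≡⟨ sym (hdot-⊕ˡ (scale b q) rest v) ⟩
    hdot (scale b q ⊕ rest) v               ≡⟨ cong (λ x → hdot x v) relation ⟩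
    hdot zeroWord v                         ≡⟨ hdot-zeroˡ v ⟩
    𝟘                                       ∎) q̸⟂v
  rest≡0 : rest ≡ zeroWord
  rest≡0 = begin
    rest                  ≡⟨ sym (⊕-identityˡ rest) ⟩
    zeroWord ⊕ rest       ≡⟨ cong (_⊕ rest) (sym (scale-𝟘 q)) ⟩
    scale 𝟘 q ⊕ rest      ≡⟨ cong (λ z → scale z q ⊕ rest) (sym b≡𝟘) ⟩
    scale b q ⊕ rest      ≡⟨ relation ⟩
    zeroWord              ∎

-- An isotropic normal vector would lie in C = v^⊥ and be orthogonal to C.
LCD⇒non-isotropic : ∀ {k} {G : Vec (Word (suc k)) k} {v : Word (suc k)} →
  LinIndep G → HermitianLCD G → Normal G v → v ≢ zeroWord → ¬ v ⟂ v
LCD⇒non-isotropic {G = G} {v} indep lcd normal v≢0 v⟂v = v≢0 (nondegenerate u⟂v)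
  where
  v∉C : ¬ InCode G v
  v∉C v∈C = v≢0 (lcd v v∈C λ y y∈C → ⟂-sym y v (normal y y∈C))
  u⟂v : ∀ u → u ⟂ v
  u⟂v u = decidable-stable (hdot u v ≟F 𝟘) λ u̸⟂v → v∉C (⟂⇒InCode indep normal u u̸⟂v v⟂v)

-- Every u is u' + μ v with u' ∈ v^⊥ = C, so x ∈ C ∩ C^⊥ is orthogonal to everything.
non-isotropic⇒LCD : ∀ {k} {G : Vec (Word (suc k)) k} {v : Word (suc k)} →
  LinIndep G → Normal G v → ¬ v ⟂ v → HermitianLCD G
non-isotropic⇒LCD {G = G} {v} indep normal v̸⟂v x x∈C x⟂C = nondegenerate u⟂x
  where
  hdot-shift : ∀ u μ y → hdot (u ⊕ scale μ v) y ≡ hdot u y +F μ *F hdot v y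
  hdot-shift u μ y = trans (hdot-⊕ˡ u (scale μ v) y) (cong (hdot u y +F_) (hdot-scaleˡ μ v y))
  u⟂x : ∀ u → u ⟂ x
  u⟂x u = begin
    hdot u x                     ≡⟨ sym (+F-identityʳ _) ⟩
    hdot u x +F 𝟘                ≡⟨ cong (hdot u x +F_) (sym (trans (cong (μ *F_) v⟂x) (*F-zeroʳ μ))) ⟩
    hdot u x +F μ *F hdot v x    ≡⟨ sym (hdot-shift u μ x) ⟩
    hdot u' x                    ≡⟨ ⟂-sym x u' (x⟂C u' (⟂⇒InCode indep normal v v̸⟂v u'⟂v)) ⟩
    𝟘                            ∎
    where
    μ = hdot u v *F conj (hdot v v)
    u' = u ⊕ scale μ v
    v⟂x : v ⟂ x
    v⟂x = ⟂-sym x v (normal x x∈C)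
    μ-cancels : μ *F hdot v v ≡ hdot u v
    μ-cancels = begin
      hdot u v *F conj (hdot v v) *F hdot v v    ≡⟨ *F-assoc (hdot u v) (conj (hdot v v)) (hdot v v) ⟩
      hdot u v *F (conj (hdot v v) *F hdot v v)  ≡⟨ cong (hdot u v *F_) (conj-inverseˡ (hdot v v) v̸⟂v) ⟩
      hdot u v *F 𝟙                              ≡⟨ *F-identityʳ (hdot u v) ⟩
      hdot u v                                   ∎
    u'⟂v : u' ⟂ v
    u'⟂v = begin
      hdot u' v                    ≡⟨ hdot-shift u μ v ⟩
      hdot u v +F μ *F hdot v v    ≡⟨ cong (hdot u v +F_) μ-cancels ⟩
      hdot u v +F hdot u v         ≡⟨ +F-self (hdot u v) ⟩
      𝟘                            ∎

weight-zeroWord : ∀ n → weight (zeroWord {n}) ≡ 0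
weight-zeroWord zero    = refl
weight-zeroWord (suc n) = weight-zeroWord n

weight-nonzero : ∀ {n} (x : Word n) → x ≢ zeroWord → 1 ≤ weight x
weight-nonzero []       x≢0 = ⊥-elim (x≢0 refl)
weight-nonzero (𝟘 ∷ x)  x≢0 = weight-nonzero x (x≢0 ∘ cong (𝟘 ∷_))
weight-nonzero (𝟙 ∷ x)  _   = s≤s z≤n
weight-nonzero (ω ∷ x)  _   = s≤s z≤n
weight-nonzero (ω² ∷ x) _   = s≤s z≤n

weight-∷ : ∀ {n} x (xs : Word n) → weight (x ∷ xs) ≤ suc (weight xs)
weight-∷ 𝟘  xs = n≤1+n (weight xs)
weight-∷ 𝟙  xs = ≤-refl
weight-∷ ω  xs = ≤-refl
weight-∷ ω² xs = ≤-refl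

weight-pair : ∀ {n} x y → weight (x ∷ y ∷ zeroWord {n}) ≤ 2
weight-pair {n} x y =
  ≤-trans (weight-∷ x _) (s≤s (≤-trans (weight-∷ y _) (s≤s (≤-reflexive (weight-zeroWord n)))))

⟂-tail≢0 : ∀ {n a b} {x v : Word n} → a ≢ 𝟘 → b ≢ 𝟘 → a ∷ x ⟂ b ∷ v → x ≢ zeroWord
⟂-tail≢0 {a = a} {b} {v = v} a≢𝟘 b≢𝟘 ab⟂ refl = *F-conj-nonzero a b a≢𝟘 b≢𝟘 (begin
  a *F conj b                        ≡⟨ sym (+F-identityʳ _) ⟩
  a *F conj b +F 𝟘                   ≡⟨ cong (a *F conj b +F_) (sym (hdot-zeroˡ v)) ⟩
  a *F conj b +F hdot zeroWord v     ≡⟨ ab⟂ ⟩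
  𝟘                                  ∎)

-- A single nonzero coordinate of x would make hdot x v a nonzero product.
⟂-full-support⇒2≤weight : ∀ {n} {v : Word n} (x : Word n) → All (_≢ 𝟘) v →
  x ≢ zeroWord → x ⟂ v → 2 ≤ weight x
⟂-full-support⇒2≤weight [] [] x≢0 _ = ⊥-elim (x≢0 refl)
⟂-full-support⇒2≤weight (𝟘 ∷ x) (_ ∷ full) x≢0 x⟂v =
  ⟂-full-support⇒2≤weight x full (x≢0 ∘ cong (𝟘 ∷_)) x⟂v
⟂-full-support⇒2≤weight (𝟙 ∷ x) (b≢𝟘 ∷ _) _ x⟂v = s≤s (weight-nonzero x (⟂-tail≢0 {a = 𝟙} (λ ()) b≢𝟘 x⟂v))
⟂-full-support⇒2≤weight (ω ∷ x)  (b≢𝟘 ∷ _) _ x⟂v = s≤s (weight-nonzero x (⟂-tail≢0 {a = ω} (λ ()) b≢𝟘 x⟂v))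
⟂-full-support⇒2≤weight (ω² ∷ x) (b≢𝟘 ∷ _) _ x⟂v = s≤s (weight-nonzero x (⟂-tail≢0 {a = ω²} (λ ()) b≢𝟘 x⟂v))

OrthogonalOfWeight≤ : ∀ {n} → ℕ → Word n → Set
OrthogonalOfWeight≤ b v = ∃ λ w → w ≢ zeroWord × weight w ≤ b × w ⟂ v

orthogonalOfWeight≤1⊎hdot-self≡length : ∀ {n} (v : Word n) → OrthogonalOfWeight≤ 1 v ⊎ hdot v v ≡ fromℕ n
orthogonalOfWeight≤1⊎hdot-self≡length []      = inj₂ refl
orthogonalOfWeight≤1⊎hdot-self≡length {suc n} (a ∷ v) with a ≟F 𝟘
... | yes refl = inj₁ (𝟙 ∷ zeroWord , (λ ()) , s≤s (≤-reflexive (weight-zeroWord n)) , hdot-zeroˡ v)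
... | no a≢𝟘 with orthogonalOfWeight≤1⊎hdot-self≡length v
...   | inj₁ (w , w≢0 , w≤1 , w⟂v) = inj₁ (𝟘 ∷ w , w≢0 ∘ cong tail , w≤1 , w⟂v)
...   | inj₂ hdot≡n = inj₂ (cong₂ _+F_ (trans (*F-comm a (conj a)) (conj-inverseˡ a a≢𝟘)) hdot≡n)

orthogonalOfWeight≤1 : ∀ {n} → n % 2 ≡ 0 → (v : Word n) → ¬ v ⟂ v → OrthogonalOfWeight≤ 1 v
orthogonalOfWeight≤1 {n} even v v̸⟂v with orthogonalOfWeight≤1⊎hdot-self≡length v
... | inj₁ short = short
... | inj₂ hdot≡n = ⊥-elim (v̸⟂v (trans hdot≡n (trans (fromℕ-mod2 n) (cong fromℕ even))))

orthogonalOfWeight≤2 : ∀ {m} (v : Word (suc (suc m))) → OrthogonalOfWeight≤ 2 v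
orthogonalOfWeight≤2 {m} (a ∷ b ∷ v) with a ≟F 𝟘
... | yes refl = 𝟙 ∷ 𝟘 ∷ zeroWord , (λ ()) , weight-pair {m} 𝟙 𝟘 , hdot-zeroˡ v
... | no a≢𝟘   = conj b ∷ conj a ∷ zeroWord
               , (λ e → a≢𝟘 (conj-zero a (cong (head ∘ tail) e)))
               , weight-pair {m} (conj b) (conj a)
               , (begin
    conj b *F conj a +F (conj a *F conj b +F hdot zeroWord v)
      ≡⟨ cong (λ z → conj b *F conj a +F (conj a *F conj b +F z)) (hdot-zeroˡ v) ⟩
    conj b *F conj a +F (conj a *F conj b +F 𝟘)
      ≡⟨ cong (conj b *F conj a +F_) (trans (+F-identityʳ _) (*F-comm (conj a) (conj b))) ⟩
    conj b *F conj a +F conj b *F conj a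
      ≡⟨ +F-self (conj b *F conj a) ⟩
    𝟘 ∎)

unitRows : ∀ k → Vec (Word k) k
unitRows zero    = []
unitRows (suc k) = (𝟙 ∷ zeroWord) ∷ zipWith _∷_ zeroWord (unitRows k)

lin-unitRows : ∀ {k} (c : Word k) → lin c (unitRows k) ≡ c
lin-unitRows []              = refl
lin-unitRows {suc k} (a ∷ c) = begin
  scale a (𝟙 ∷ zeroWord) ⊕ lin c (zipWith _∷_ zeroWord (unitRows k))
    ≡⟨ cong (scale a (𝟙 ∷ zeroWord) ⊕_) (lin-zipWith-∷ c zeroWord (unitRows k)) ⟩
  a *F 𝟙 +F zeroWord · c ∷ scale a zeroWord ⊕ lin c (unitRows k)
    ≡⟨ cong₂ (λ s w → a *F 𝟙 +F s ∷ w ⊕ lin c (unitRows k)) (trans (·-comm zeroWord c) (·-zeroʳ c)) (scale-zeroWord a) ⟩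
  a *F 𝟙 +F 𝟘 ∷ zeroWord ⊕ lin c (unitRows k)
    ≡⟨ cong₂ _∷_ (trans (+F-identityʳ (a *F 𝟙)) (*F-identityʳ a)) (trans (⊕-identityˡ _) (lin-unitRows c)) ⟩
  a ∷ c
    ∎

-- The generator matrix [a | I], with the column a first.
systematic : ∀ {k} → Word k → Vec (Word (suc k)) k
systematic {k} a = zipWith _∷_ a (unitRows k)

lin-systematic : ∀ {k} (a c : Word k) → lin c (systematic a) ≡ a · c ∷ c
lin-systematic {k} a c = trans (lin-zipWith-∷ c a (unitRows k)) (cong (a · c ∷_) (lin-unitRows c))

systematic-independent : ∀ {k} (a : Word k) → LinIndep (systematic a)
systematic-independent a c c↦0 = trans (sym (cong tail (lin-systematic a c))) (cong tail c↦0)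

systematic-normal : ∀ {k} (a : Word k) → Normal (systematic a) (𝟙 ∷ map conj a)
systematic-normal a _ (c , refl) = begin
  hdot (lin c (systematic a)) (𝟙 ∷ map conj a)
    ≡⟨ cong (λ x → hdot x (𝟙 ∷ map conj a)) (lin-systematic a c) ⟩
  a · c *F 𝟙 +F hdot c (map conj a)
    ≡⟨ cong₂ _+F_ (*F-identityʳ (a · c)) (trans (hdot-map-conj c a) (·-comm c a)) ⟩
  a · c +F a · c
    ≡⟨ +F-self (a · c) ⟩
  𝟘 ∎

short-codeword : ∀ {k b} {G : Vec (Word (suc k)) k} →
  (∀ v → ¬ v ⟂ v → OrthogonalOfWeight≤ b v) → LinIndep G → HermitianLCD G →
  ∃ λ w → InCode G w × w ≢ zeroWord × weight w ≤ b
short-codeword {G = G} short indep lcd =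
  let v , v≢0 , normal     = normal-exists G
      v̸⟂v                 = LCD⇒non-isotropic indep lcd normal v≢0
      w , w≢0 , w≤b , w⟂v = short v v̸⟂v
  in w , ⟂⇒InCode indep normal v v̸⟂v w⟂v , w≢0 , w≤b

D4≡-codim-one : ∀ {k d} → (∀ (v : Word (suc k)) → ¬ v ⟂ v → OrthogonalOfWeight≤ d v) →
  (G : Vec (Word (suc k)) k) → LinIndep G → HermitianLCD G →
  (∀ x → InCode G x → x ≢ zeroWord → d ≤ weight x) → D4≡ (suc k) k d
D4≡-codim-one short G indep lcd d≤weight =
  let w , w∈C , w≢0 , w≤d = short-codeword short indep lcd
  in  (G , indep , lcd , (w , w∈C , w≢0 , ≤-antisym w≤d (d≤weight w w∈C w≢0)) , d≤weight)
    , λ G′ d′ indep′ lcd′ (_ , d′≤weight) →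
        let w′ , w′∈C , w′≢0 , w′≤d = short-codeword short indep′ lcd′
        in  ≤-trans (d′≤weight w′ w′∈C w′≢0) w′≤d

systematic-zeroWord-normal : ∀ k → Normal (systematic (zeroWord {k})) (𝟙 ∷ zeroWord)
systematic-zeroWord-normal k =
  subst (Normal (systematic zeroWord)) (cong (𝟙 ∷_) (map-replicate conj 𝟘 k)) (systematic-normal zeroWord)

systematic-ones-normal : ∀ k → Normal (systematic (replicate k 𝟙)) (replicate (suc k) 𝟙)
systematic-ones-normal k =
  subst (Normal (systematic (replicate k 𝟙))) (cong (𝟙 ∷_) (map-replicate conj 𝟙 k)) (systematic-normal (replicate k 𝟙))

e₁-non-isotropic : ∀ k → ¬ 𝟙 ∷ zeroWord {k} ⟂ 𝟙 ∷ zeroWord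
e₁-non-isotropic k isotropic with trans (sym (cong (𝟙 +F_) (hdot-zeroˡ (zeroWord {k})))) isotropic
... | ()

hdot-ones : ∀ n → hdot (replicate n 𝟙) (replicate n 𝟙) ≡ fromℕ n
hdot-ones zero    = refl
hdot-ones (suc n) = cong (𝟙 +F_) (hdot-ones n)

ones-non-isotropic : ∀ n → n % 2 ≡ 1 → ¬ replicate n 𝟙 ⟂ replicate n 𝟙
ones-non-isotropic n odd isotropic
  with trans (sym (trans (hdot-ones n) (trans (fromℕ-mod2 n) (cong fromℕ odd)))) isotropic
... | ()

ones-full-support : ∀ n → All (_≢ 𝟘) (replicate n 𝟙)
ones-full-support zero    = []
ones-full-support (suc n) = (λ ()) ∷ ones-full-support n

proposition3p1 : ∀ (n : ℕ) → 2 ≤ n →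
    (n % 2 ≡ 0 → D4≡ n (n ∸ 1) 1) × (n % 2 ≡ 1 → D4≡ n (n ∸ 1) 2)
proposition3p1 n@(suc (suc m)) (s≤s (s≤s z≤n)) = even-length , odd-length
  where
  k = suc m
  zeros ones : Word k
  zeros = zeroWord
  ones  = replicate k 𝟙

  even-length : n % 2 ≡ 0 → D4≡ n k 1
  even-length even = D4≡-codim-one (orthogonalOfWeight≤1 even)
    (systematic zeros) (systematic-independent zeros)
    (non-isotropic⇒LCD (systematic-independent zeros) (systematic-zeroWord-normal k) (e₁-non-isotropic k))
    (λ x _ → weight-nonzero x)

  odd-length : n % 2 ≡ 1 → D4≡ n k 2
  odd-length odd = D4≡-codim-one (λ v _ → orthogonalOfWeight≤2 v)
    (systematic ones) (systematic-independent ones)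
    (non-isotropic⇒LCD (systematic-independent ones) (systematic-ones-normal k) (ones-non-isotropic n odd))
    (λ x x∈C x≢0 → ⟂-full-support⇒2≤weight x (ones-full-support n) x≢0 (systematic-ones-normal k x x∈C))
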